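{- Let $\varphi=(1+\sqrt5)/2$ and let $f:\mathbb{N}\to\mathbb{N}$ be the sequence defined by $f(0)=0$ and, for $n\ge 1$, $f(n)$ is the least natural number such that $f(n)\notin\{f(0),f(1),\ldots,f(n-1)\}$ and $\sum_{1\le i\le n} f(i)$ is divisible by $n$. Then for every $n\ge 1$, $$f(n)=\begin{cases}\lfloor n\varphi\rfloor, & \text{if there exists } m\in\mathbb{N} \text{ with } n-1=\lfloor m\varphi\rfloor,\\ \lfloor n/\varphi\rfloor+1, & \text{otherwise.}\end{cases}$$
   Context: $\mathbb{N}=\{0,1,2,\ldots\}$. The sequence $f$ begins $0,1,3,2,6,8,4,11,5,14,16,7,\ldots$ (OEIS A019444). -}

module Defs where

open import Data.Nat using (ℕ; zero; suc; _+_; _*_; _∸_; _^_; _≤_; _<_)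
open import Data.Nat.Divisibility using (_∣_)
open import Data.Product using (_×_)
open import Relation.Nullary using (¬_)
open import Relation.Binary.PropositionalEquality using (_≢_)

-- φ = (1 + √5)/2.  For naturals k, n:
--   k ≤ n·φ  ⇔  2k − n ≤ n√5  ⇔  (2k ≤ n) or (2k − n)² ≤ 5n²
-- which (with truncated subtraction) is exactly (2k ∸ n)² ≤ 5n².
LeMulPhi : ℕ → ℕ → Set
LeMulPhi n k = ((2 * k) ∸ n) ^ 2 ≤ 5 * n ^ 2

IsFloorMulPhi : ℕ → ℕ → Set
IsFloorMulPhi n k = LeMulPhi n k × ¬ LeMulPhi n (suc k)

-- n / φ = n(√5 − 1)/2.  k ≤ n/φ ⇔ 2k + n ≤ n√5 ⇔ (2k + n)² ≤ 5n².
LeDivPhi : ℕ → ℕ → Set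
LeDivPhi n k = (2 * k + n) ^ 2 ≤ 5 * n ^ 2

IsFloorDivPhi : ℕ → ℕ → Set
IsFloorDivPhi n k = LeDivPhi n k × ¬ LeDivPhi n (suc k)

Σ1 : (ℕ → ℕ) → ℕ → ℕ
Σ1 f zero = 0
Σ1 f (suc m) = Σ1 f m + f (suc m)

Admissible : (ℕ → ℕ) → ℕ → ℕ → Set
Admissible f m y = (∀ i → i < suc m → f i ≢ y) × (suc m ∣ Σ1 f m + y)

IsA019444 : (ℕ → ℕ) → Set
IsA019444 f = (f 0 ≡ 0) × (∀ m → Admissible f m (f (suc m)) × (∀ y → y < f (suc m) → ¬ Admissible f m y))
  where open import Relation.Binary.PropositionalEquality using (_≡_)

{-# OPTIONS --safe #-}
module Submission where

-- Let a(k) = ⌊kφ⌋ and b(k) = ⌊kφ²⌋ = a(k) + k, the complementary Beatty sequences. The closed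
-- form σ of the theorem swaps a(k) + 1 ↔ b(k) + 1 (k ≥ 1) and fixes 0 and 1, so it is an
-- involution, and σ(1) + … + σ(m) = m(⌊m/φ⌋ + 1); hence every σ(m + 1) is admissible. It is
-- also the least admissible value: after m = a(k) a smaller admissible y lies below m + 1 + k
-- and is ≡ k (mod m + 1), so y = k = σ(σ(k)) is already taken; after m = b(k), σ(m + 1) ≤ m
-- leaves no room. The greedy definition determines the sequence, so f = σ.

open import Data.Bool using (if_then_else_)
open import Data.Empty using (⊥-elim)
open import Data.Nat using (ℕ; zero; suc; _+_; _*_; _∸_; _^_; _≤_; _<_; _≤?_; z≤n; s≤s; >-nonZero)
open import Data.Nat.Divisibility using (_∣_; ∣m+n∣m⇒∣n; ∣⇒≤; n∣n; m∣m*n)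
open import Data.Nat.Induction using (<-rec)
open import Data.Nat.Properties
open import Data.Nat.Tactic.RingSolver using (solve-∀)
open import Data.Product using (_×_; _,_; proj₁; proj₂; ∃)
open import Data.Sum using (_⊎_; inj₁; inj₂)
open import Relation.Binary.Definitions using (tri<; tri≈; tri>)
open import Relation.Binary.PropositionalEquality
open import Relation.Nullary using (¬_; Dec; does; yes; no)
open import Relation.Nullary.Decidable using (map′)

open import Defs

infix 4 _≤φ·_ _<φ·_ _>φ·_ _≤φ·?_

-- y ≤ φk ⇔ y² ≤ yk + k², since φ is the positive root of t² = t + 1.
data _≤φ·_ (y k : ℕ) : Set where
  leφ : y * y ≤ y * k + k * k → y ≤φ· k

data _<φ·_ (y k : ℕ) : Set where
  ltφ : y * y < y * k + k * k → y <φ· k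

data _>φ·_ (y k : ℕ) : Set where
  gtφ : y * k + k * k < y * y → y >φ· k

-- Opaque, so that `with` can abstract the decision taken in ⌊_φ⌋ and σ.
opaque
  _≤φ·?_ : ∀ y k → Dec (y ≤φ· k)
  y ≤φ·? k = map′ leφ (λ { (leφ p) → p }) (y * y ≤? y * k + k * k)

<φ·⇒≤φ· : ∀ {y k} → y <φ· k → y ≤φ· k
<φ·⇒≤φ· (ltφ p) = leφ (<⇒≤ p)

>φ·⇒≰φ· : ∀ {y k} → y >φ· k → ¬ y ≤φ· k
>φ·⇒≰φ· (gtφ p) (leφ q) = <⇒≱ p q

<φ·⇒≯φ· : ∀ {y k} → y <φ· k → ¬ y >φ· k
<φ·⇒≯φ· (ltφ p) (gtφ q) = <-asym p q

≰φ·⇒>φ· : ∀ {y k} → ¬ y ≤φ· k → y >φ· k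
≰φ·⇒>φ· y≰φk = gtφ (≰⇒> λ p → y≰φk (leφ p))

≯φ·⇒≤φ· : ∀ {y k} → ¬ y >φ· k → y ≤φ· k
≯φ·⇒≤φ· y≯φk = leφ (≮⇒≥ λ p → y≯φk (gtφ p))

cross-< : ∀ {a b c d} → a + d ≡ b + c → a < b → c < d
cross-< {a} {b} {c} {d} eq a<b = +-cancelˡ-< b c d (subst (_< b + d) eq (+-monoˡ-< d a<b))

cross-≤ : ∀ {a b c d} → a + d ≡ b + c → a ≤ b → c ≤ d
cross-≤ {a} {b} {c} {d} eq a≤b = +-cancelˡ-≤ b c d (subst (_≤ b + d) eq (+-monoˡ-≤ d a≤b))

-- y < φx ⇔ (y + x)/y > φ, because t ↦ 1 + 1/t exchanges the two sides of φ.
φ-swap : ∀ y x → y * y + (y + x) * (y + x) ≡ (y * x + x * x) + ((y + x) * y + y * y)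
φ-swap = solve-∀

φ-swap′ : ∀ y x → ((y + x) * y + y * y) + (y * x + x * x) ≡ (y + x) * (y + x) + y * y
φ-swap′ = solve-∀

<φ·⇒+>φ· : ∀ {y x} → y <φ· x → y + x >φ· y
<φ·⇒+>φ· {y} {x} (ltφ p) = gtφ (cross-< (φ-swap y x) p)

+>φ·⇒<φ· : ∀ {y x} → y + x >φ· y → y <φ· x
+>φ·⇒<φ· {y} {x} (gtφ p) = ltφ (cross-< (φ-swap′ y x) p)

>φ·⇒+<φ· : ∀ {y x} → y >φ· x → y + x <φ· y
>φ·⇒+<φ· {y} {x} (gtφ p) = ltφ (cross-< (sym (φ-swap y x)) p)

+<φ·⇒>φ· : ∀ {y x} → y + x <φ· y → y >φ· x
+<φ·⇒>φ· {y} {x} (ltφ p) = gtφ (cross-< (sym (φ-swap′ y x)) p)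

≤⇒≤φ· : ∀ {y k} → y ≤ k → y ≤φ· k
≤⇒≤φ· {y} {k} y≤k = leφ (≤-trans (*-monoʳ-≤ y y≤k) (m≤m+n (y * k) (k * k)))

>φ·⇒≥ : ∀ {y k} → y >φ· k → k ≤ y
>φ·⇒≥ y>φk = ≮⇒≥ λ y<k → >φ·⇒≰φ· y>φk (≤⇒≤φ· (<⇒≤ y<k))

>φ·-mono-≤ : ∀ {y y′ k} → y >φ· k → y ≤ y′ → y′ >φ· k
>φ·-mono-≤ {y} {y′} {k} y>φk@(gtφ p) y≤y′ = subst (_>φ· k) (m+[n∸m]≡n y≤y′) (gtφ (shift (y′ ∸ y)))
  where
    lhs : ∀ y k t → (y + t) * k + k * k ≡ (y * k + k * k) + t * k
    lhs = solve-∀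
    rhs : ∀ y t → (y + t) * (y + t) ≡ y * y + t * (y + y + t)
    rhs = solve-∀
    shift : ∀ t → (y + t) * k + k * k < (y + t) * (y + t)
    shift t = subst₂ _<_ (sym (lhs y k t)) (sym (rhs y t))
      (+-mono-<-≤ p (*-monoʳ-≤ t (≤-trans (>φ·⇒≥ y>φk) (≤-trans (m≤m+n y y) (m≤m+n (y + y) t)))))

≤φ·-anti-≤ : ∀ {y y′ k} → y ≤φ· k → y′ ≤ y → y′ ≤φ· k
≤φ·-anti-≤ y≤φk y′≤y = ≯φ·⇒≤φ· λ y′>φk → >φ·⇒≰φ· (>φ·-mono-≤ y′>φk y′≤y) y≤φk

2*≤⇒>φ· : ∀ {y k} → k + k ≤ y → 0 < y → y >φ· k
2*≤⇒>φ· {y} {zero} _ 0<y =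
  gtφ (subst (_< y * y) (sym (trans (+-identityʳ (y * 0)) (*-zeroʳ y))) (*-monoˡ-< y ⦃ >-nonZero 0<y ⦄ 0<y))
2*≤⇒>φ· {y} {k@(suc _)} 2k≤y _ = gtφ (begin-strict
  y * k + k * k  <⟨ +-monoʳ-< (y * k) (*-monoˡ-< k (≤-trans (m<m+n k (s≤s z≤n)) 2k≤y)) ⟩
  y * k + y * k  ≡⟨ *-distribˡ-+ y k k ⟨
  y * (k + k)    ≤⟨ *-monoʳ-≤ y 2k≤y ⟩
  y * y          ∎)
  where open ≤-Reasoning

≤φ·⇒≤2* : ∀ {y k} → y ≤φ· k → y ≤ k + k
≤φ·⇒≤2* y≤φk = ≮⇒≥ λ 2k<y → >φ·⇒≰φ· (2*≤⇒>φ· (<⇒≤ 2k<y) (≤-<-trans z≤n 2k<y)) y≤φk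

≤φ·⇒<2* : ∀ {y k} → 1 ≤ k → y ≤φ· k → y < k + k
≤φ·⇒<2* {y} {k} 1≤k y≤φk = ≤∧≢⇒< (≤φ·⇒≤2* y≤φk) λ y≡2k → >φ·⇒≰φ·
  (2*≤⇒>φ· (≤-reflexive (sym y≡2k)) (≤-trans 1≤k (≤-trans (m≤m+n k k) (≤-reflexive (sym y≡2k))))) y≤φk

private
  square-suc : ∀ y → suc y * suc y ≡ y * y + suc (y + y)
  square-suc = solve-∀

  φ·-suc-expand : ∀ y k → suc y * suc k + suc k * suc k ≡ (y * k + k * k) + suc (suc (y + 3 * k))
  φ·-suc-expand = solve-∀

  suc-growth : ∀ y k → y ≤ k + k → suc (y + y) ≤ suc (suc (y + 3 * k))
  suc-growth y k y≤2k = s≤s (≤-trans (+-monoʳ-≤ y (≤-trans y≤2k (+-monoʳ-≤ k (m≤m+n k (k + 0))))) (n≤1+n _))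

≤φ·-suc : ∀ {y k} → y ≤φ· k → suc y ≤φ· suc k
≤φ·-suc {y} {k} y≤φk@(leφ p) = leφ (subst₂ _≤_ (sym (square-suc y)) (sym (φ·-suc-expand y k))
  (+-mono-≤ p (suc-growth y k (≤φ·⇒≤2* y≤φk))))

<φ·-suc : ∀ {y k} → y <φ· k → suc y <φ· suc k
<φ·-suc {y} {k} y<φk@(ltφ p) = ltφ (subst₂ _<_ (sym (square-suc y)) (sym (φ·-suc-expand y k))
  (+-mono-<-≤ p (suc-growth y k (≤φ·⇒≤2* (<φ·⇒≤φ· y<φk)))))

>φ·-suc : ∀ {y k} → y >φ· k → suc (suc y) >φ· suc k
>φ·-suc {y} {k} y>φk =
  subst (_>φ· suc k) k+t≡y′ (<φ·⇒+>φ· (<φ·-suc (+>φ·⇒<φ· (subst (_>φ· k) (sym k+t≡y) y>φk))))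
  where
    t = y ∸ k
    k+t≡y : k + t ≡ y
    k+t≡y = m+[n∸m]≡n (>φ·⇒≥ y>φk)
    k+t≡y′ : suc k + suc t ≡ suc (suc y)
    k+t≡y′ = cong suc (trans (+-suc k t) (cong suc k+t≡y))

-- Infinite descent: a solution (y, k) yields the smaller solution (k, y − k).
φ·-irrational : ∀ k y → 1 ≤ k → y * y ≢ y * k + k * k
φ·-irrational = <-rec _ descent
  where
    descent : ∀ k → (∀ {t} → t < k → ∀ y → 1 ≤ t → y * y ≢ y * t + t * t) →
              ∀ y → 1 ≤ k → y * y ≢ y * k + k * k
    descent k@(suc _) rec y 1≤k eq = rec t<k k (m<n⇒0<n∸m k<y) smaller
      where
        k<y : k < y
        k<y = ≰⇒> λ y≤k → <-irrefl eq (≤-<-trans (*-monoʳ-≤ y y≤k) (m<m+n (y * k) (s≤s z≤n)))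
        t = y ∸ k
        k+t≡y : k + t ≡ y
        k+t≡y = m+[n∸m]≡n (<⇒≤ k<y)
        eq′ : (k + t) * (k + t) ≡ (k + t) * k + k * k
        eq′ = subst (λ u → u * u ≡ u * k + k * k) (sym k+t≡y) eq
        smaller : k * k ≡ k * t + t * t
        smaller = +-cancelʳ-≡ _ _ _ (trans (φ-swap k t) (cong (k * t + t * t +_) (sym eq′)))
        t<k : t < k
        t<k = +-cancelˡ-< k t k (subst (_< k + k) (sym k+t≡y) (≤φ·⇒<2* 1≤k (leφ (≤-reflexive eq))))

≤φ·⇒<φ· : ∀ {y k} → 1 ≤ k → y ≤φ· k → y <φ· k
≤φ·⇒<φ· {y} {k} 1≤k (leφ p) = ltφ (≤∧≢⇒< p (φ·-irrational k y 1≤k))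

⌊_φ⌋ : ℕ → ℕ
⌊ zero φ⌋ = 0
⌊ suc k φ⌋ = if does (2 + ⌊ k φ⌋ ≤φ·? suc k) then 2 + ⌊ k φ⌋ else suc ⌊ k φ⌋

⌊φ⌋-step : ∀ k → ⌊ suc k φ⌋ ≡ 2 + ⌊ k φ⌋ ⊎ ⌊ suc k φ⌋ ≡ suc ⌊ k φ⌋
⌊φ⌋-step k with 2 + ⌊ k φ⌋ ≤φ·? suc k
... | yes _ = inj₁ refl
... | no _ = inj₂ refl

⌊φ⌋-floor : ∀ k → ⌊ k φ⌋ ≤φ· k × suc ⌊ k φ⌋ >φ· k
⌊φ⌋-floor zero = leφ z≤n , gtφ (s≤s z≤n)
⌊φ⌋-floor (suc k) with 2 + ⌊ k φ⌋ ≤φ·? suc k | ⌊φ⌋-floor k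
... | yes jump | _ , above = jump , >φ·-suc above
... | no ¬jump | below , _ = ≤φ·-suc below , ≰φ·⇒>φ· ¬jump

⌊φ⌋-unique : ∀ {k y} → y ≤φ· k → suc y >φ· k → ⌊ k φ⌋ ≡ y
⌊φ⌋-unique {k} y≤φk 1+y>φk = ≤-antisym
  (≮⇒≥ λ y<⌊kφ⌋ → >φ·⇒≰φ· (>φ·-mono-≤ 1+y>φk y<⌊kφ⌋) (proj₁ (⌊φ⌋-floor k)))
  (≮⇒≥ λ ⌊kφ⌋<y → >φ·⇒≰φ· (>φ·-mono-≤ (proj₂ (⌊φ⌋-floor k)) ⌊kφ⌋<y) y≤φk)

n≤⌊nφ⌋ : ∀ n → n ≤ ⌊ n φ⌋
n≤⌊nφ⌋ n = ≮⇒≥ λ ⌊nφ⌋<n → >φ·⇒≰φ· (proj₂ (⌊φ⌋-floor n)) (≤⇒≤φ· ⌊nφ⌋<n)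

⌊1φ⌋ : ⌊ 1 φ⌋ ≡ 1
⌊1φ⌋ = ⌊φ⌋-unique (leφ (s≤s z≤n)) (gtφ (s≤s (s≤s (s≤s (s≤s z≤n)))))

-- 1/φ = φ − 1
⌊_/φ⌋ : ℕ → ℕ
⌊ n /φ⌋ = ⌊ n φ⌋ ∸ n

⌊φ⌋≡+⌊/φ⌋ : ∀ n → ⌊ n φ⌋ ≡ n + ⌊ n /φ⌋
⌊φ⌋≡+⌊/φ⌋ n = sym (m+[n∸m]≡n (n≤⌊nφ⌋ n))

1+⌊φ⌋≡+1+⌊/φ⌋ : ∀ n → suc ⌊ n φ⌋ ≡ n + suc ⌊ n /φ⌋
1+⌊φ⌋≡+1+⌊/φ⌋ n = trans (cong suc (⌊φ⌋≡+⌊/φ⌋ n)) (sym (+-suc n ⌊ n /φ⌋))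

⌊/φ⌋≤ : ∀ n → ⌊ n /φ⌋ ≤ n
⌊/φ⌋≤ n = subst (⌊ n /φ⌋ ≤_) (m+n∸m≡n n n) (∸-monoˡ-≤ n (≤φ·⇒≤2* (proj₁ (⌊φ⌋-floor n))))

⌊/φ⌋< : ∀ {n} → 1 ≤ n → ⌊ n /φ⌋ < n
⌊/φ⌋< {n} 1≤n = +-cancelˡ-< n ⌊ n /φ⌋ n
  (subst (_< n + n) (⌊φ⌋≡+⌊/φ⌋ n) (≤φ·⇒<2* 1≤n (proj₁ (⌊φ⌋-floor n))))

⌊/φ⌋-jump₂ : ∀ {m} → ⌊ suc m φ⌋ ≡ 2 + ⌊ m φ⌋ → ⌊ suc m /φ⌋ ≡ suc ⌊ m /φ⌋
⌊/φ⌋-jump₂ {m} jump = trans (cong (_∸ suc m) jump) (+-∸-assoc 1 (n≤⌊nφ⌋ m))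

⌊/φ⌋-jump₁ : ∀ {m} → ⌊ suc m φ⌋ ≡ suc ⌊ m φ⌋ → ⌊ suc m /φ⌋ ≡ ⌊ m /φ⌋
⌊/φ⌋-jump₁ {m} jump = cong (_∸ suc m) jump

-- With t = 2k ∸ n, this gives 4k² ≤ 4(kn + n²) ⇔ t² ≤ 5n² when n ≤ 2k.
mulPhi-identity : ∀ t n k → t + n ≡ 2 * k → t ^ 2 + 4 * (k * n + n * n) ≡ 5 * n ^ 2 + 4 * (k * k)
mulPhi-identity t n k t+n≡2k = begin
  t ^ 2 + 4 * (k * n + n * n)                ≡⟨ cong (t ^ 2 +_) (quadruple k n) ⟩
  t ^ 2 + (2 * (2 * k) * n + 4 * (n * n))    ≡⟨ cong (λ u → t ^ 2 + (2 * u * n + 4 * (n * n))) (sym t+n≡2k) ⟩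
  t ^ 2 + (2 * (t + n) * n + 4 * (n * n))    ≡⟨ expand t n ⟩
  5 * n ^ 2 + (t + n) * (t + n)              ≡⟨ cong (λ u → 5 * n ^ 2 + u * u) t+n≡2k ⟩
  5 * n ^ 2 + 2 * k * (2 * k)                ≡⟨ cong (5 * n ^ 2 +_) (double-square k) ⟩
  5 * n ^ 2 + 4 * (k * k)                    ∎
  where
    open ≡-Reasoning
    quadruple : ∀ k n → 4 * (k * n + n * n) ≡ 2 * (2 * k) * n + 4 * (n * n)
    quadruple = solve-∀
    expand : ∀ t n → t * (t * 1) + (2 * (t + n) * n + 4 * (n * n)) ≡ 5 * (n * (n * 1)) + (t + n) * (t + n)
    expand = solve-∀
    double-square : ∀ k → 2 * k * (2 * k) ≡ 4 * (k * k)
    double-square = solve-∀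

≤φ·⇒LeMulPhi : ∀ {k n} → k ≤φ· n → LeMulPhi n k
≤φ·⇒LeMulPhi {k} {n} (leφ p) with n ≤? 2 * k
... | yes n≤2k = cross-≤ identity (*-monoʳ-≤ 4 p)
  where
    t = 2 * k ∸ n
    identity : 4 * (k * k) + 5 * n ^ 2 ≡ 4 * (k * n + n * n) + t ^ 2
    identity = trans (+-comm (4 * (k * k)) (5 * n ^ 2))
      (trans (sym (mulPhi-identity t n k (m∸n+n≡m n≤2k))) (+-comm (t ^ 2) (4 * (k * n + n * n))))
... | no n≰2k = subst (λ t → t ^ 2 ≤ 5 * n ^ 2) (sym (m≤n⇒m∸n≡0 (<⇒≤ (≰⇒> n≰2k)))) z≤n

LeMulPhi⇒≤φ· : ∀ n k → LeMulPhi n k → k ≤φ· n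
LeMulPhi⇒≤φ· n k le with n ≤? 2 * k
... | yes n≤2k = leφ (*-cancelˡ-≤ 4 (cross-≤ (mulPhi-identity _ n k (m∸n+n≡m n≤2k)) le))
... | no n≰2k = ≤⇒≤φ· (≤-trans (m≤m+n k (k + 0)) (<⇒≤ (≰⇒> n≰2k)))

⌊φ⌋-isFloorMulPhi : ∀ n → IsFloorMulPhi n ⌊ n φ⌋
⌊φ⌋-isFloorMulPhi n = ≤φ·⇒LeMulPhi (proj₁ (⌊φ⌋-floor n)) ,
  λ le → >φ·⇒≰φ· (proj₂ (⌊φ⌋-floor n)) (LeMulPhi⇒≤φ· n (suc ⌊ n φ⌋) le)

isFloorMulPhi⇒⌊φ⌋≡ : ∀ n {y} → IsFloorMulPhi n y → ⌊ n φ⌋ ≡ y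
isFloorMulPhi⇒⌊φ⌋≡ n {y} (below , ¬above) =
  ⌊φ⌋-unique (LeMulPhi⇒≤φ· n y below) (≰φ·⇒>φ· λ le → ¬above (≤φ·⇒LeMulPhi le))

⌊/φ⌋-isFloorDivPhi : ∀ n → IsFloorDivPhi n ⌊ n /φ⌋
⌊/φ⌋-isFloorDivPhi n
  with subst (IsFloorMulPhi n) (trans (⌊φ⌋≡+⌊/φ⌋ n) (+-comm n ⌊ n /φ⌋)) (⌊φ⌋-isFloorMulPhi n)
... | below , ¬above =
  subst Bounded (shift ⌊ n /φ⌋) below , λ le → ¬above (subst Bounded (sym (shift (suc ⌊ n /φ⌋))) le)
  where
    Bounded : ℕ → Set
    Bounded t = t ^ 2 ≤ 5 * n ^ 2
    double : ∀ z n → 2 * (z + n) ≡ (2 * z + n) + n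
    double = solve-∀
    shift : ∀ z → 2 * (z + n) ∸ n ≡ 2 * z + n
    shift z = trans (cong (_∸ n) (double z n)) (m+n∸n≡m (2 * z + n) n)

-- φ² = φ + 1
⌊_φ²⌋ : ℕ → ℕ
⌊ k φ²⌋ = ⌊ k φ⌋ + k

module _ (k′ : ℕ) where
  private
    k = suc k′
    x = ⌊ k φ⌋
    N = ⌊ k φ²⌋

    x<φk : x <φ· k
    x<φk = ≤φ·⇒<φ· (s≤s z≤n) (proj₁ (⌊φ⌋-floor k))

    N>φx : N >φ· x
    N>φx = <φ·⇒+>φ· x<φk

    1+N<φ1+x : suc N <φ· suc x
    1+N<φ1+x = >φ·⇒+<φ· (proj₂ (⌊φ⌋-floor k))

  ⌊φ⌋-at-lower : ⌊ x φ⌋ ≡ x + k′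
  ⌊φ⌋-at-lower = ⌊φ⌋-unique below (subst (_>φ· x) (+-suc x k′) N>φx)
    where
      below : x + k′ ≤φ· x
      below = ≯φ·⇒≤φ· λ above →
        <φ·⇒≯φ· 1+N<φ1+x (subst (_>φ· suc x) (sym (cong suc (+-suc x k′))) (>φ·-suc above))

  ⌊φ⌋-after-lower : ⌊ suc x φ⌋ ≡ suc N
  ⌊φ⌋-after-lower = ⌊φ⌋-unique (<φ·⇒≤φ· 1+N<φ1+x) (>φ·-suc N>φx)

  ⌊φ⌋-at-upper : ⌊ N φ⌋ ≡ N + x
  ⌊φ⌋-at-upper = ⌊φ⌋-unique (<φ·⇒≤φ· (>φ·⇒+<φ· N>φx)) (subst (_>φ· N) (+-suc N x) (<φ·⇒+>φ· N<φ1+x))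
    where
      N<φ1+x : N <φ· suc x
      N<φ1+x = ≤φ·⇒<φ· (s≤s z≤n) (≤φ·-anti-≤ (<φ·⇒≤φ· 1+N<φ1+x) (n≤1+n N))

  ⌊φ⌋-after-upper : ⌊ suc N φ⌋ ≡ suc N + x
  ⌊φ⌋-after-upper = ⌊φ⌋-unique (<φ·⇒≤φ· (>φ·⇒+<φ· (>φ·-mono-≤ N>φx (n≤1+n N))))
    (subst (_>φ· suc N) (+-suc (suc N) x) (<φ·⇒+>φ· 1+N<φ1+x))

  ⌊φ⌋-jump-at-lower : ⌊ suc x φ⌋ ≡ 2 + ⌊ x φ⌋
  ⌊φ⌋-jump-at-lower = trans ⌊φ⌋-after-lower (cong suc (trans (+-suc x k′) (cong suc (sym ⌊φ⌋-at-lower))))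

  ⌊φ⌋-jump-at-upper : ⌊ suc N φ⌋ ≡ suc ⌊ N φ⌋
  ⌊φ⌋-jump-at-upper = trans ⌊φ⌋-after-upper (cong suc (sym ⌊φ⌋-at-upper))

jump₂⇒lower : ∀ m → ⌊ suc m φ⌋ ≡ 2 + ⌊ m φ⌋ → ⌊ suc ⌊ m /φ⌋ φ⌋ ≡ m
jump₂⇒lower m jump = ⌊φ⌋-unique
  (<φ·⇒≤φ· (+>φ·⇒<φ· (subst (_>φ· m) (1+⌊φ⌋≡+1+⌊/φ⌋ m) (proj₂ (⌊φ⌋-floor m)))))
  (+<φ·⇒>φ· (subst (_<φ· suc m) ⌊1+mφ⌋≡ (≤φ·⇒<φ· (s≤s z≤n) (proj₁ (⌊φ⌋-floor (suc m))))))
  where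
    z = ⌊ m /φ⌋
    ⌊1+mφ⌋≡ : ⌊ suc m φ⌋ ≡ suc m + suc z
    ⌊1+mφ⌋≡ = trans jump (cong suc (1+⌊φ⌋≡+1+⌊/φ⌋ m))

jump₁⇒upper : ∀ {m} → 1 ≤ m → ⌊ suc m φ⌋ ≡ suc ⌊ m φ⌋ → ∃ λ k → ⌊ suc k φ²⌋ ≡ m
jump₁⇒upper {m} 1≤m jump = k , trans (cong (_+ suc k) ⌊1+kφ⌋≡z) m≡z+1+k
  where
    z = ⌊ m /φ⌋
    k = m ∸ suc z
    m≡z+1+k : z + suc k ≡ m
    m≡z+1+k = trans (+-suc z k) (m+[n∸m]≡n (⌊/φ⌋< 1≤m))
    m>φz : m >φ· z
    m>φz = +<φ·⇒>φ· (subst (_<φ· m) (⌊φ⌋≡+⌊/φ⌋ m) (≤φ·⇒<φ· 1≤m (proj₁ (⌊φ⌋-floor m))))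
    1+m<φ1+z : suc m <φ· suc z
    1+m<φ1+z = +>φ·⇒<φ· (subst (_>φ· suc m) (cong suc (trans jump (1+⌊φ⌋≡+1+⌊/φ⌋ m)))
                                              (proj₂ (⌊φ⌋-floor (suc m))))
    ⌊1+kφ⌋≡z : ⌊ suc k φ⌋ ≡ z
    ⌊1+kφ⌋≡z = ⌊φ⌋-unique
      (<φ·⇒≤φ· (+>φ·⇒<φ· (subst (_>φ· z) (sym m≡z+1+k) m>φz)))
      (+<φ·⇒>φ· (subst (_<φ· suc z) (cong suc (sym m≡z+1+k)) 1+m<φ1+z))

data BeattyView : ℕ → Set where
  origin : BeattyView 0
  lower  : ∀ k → BeattyView ⌊ suc k φ⌋
  upper  : ∀ k → BeattyView ⌊ suc k φ²⌋

beattyView : ∀ m → BeattyView m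
beattyView zero = origin
beattyView (suc m) with ⌊φ⌋-step (suc m)
... | inj₁ jump = subst BeattyView (jump₂⇒lower (suc m) jump) (lower ⌊ suc m /φ⌋)
... | inj₂ jump with jump₁⇒upper (s≤s z≤n) jump
...   | k , ⌊1+kφ²⌋≡ = subst BeattyView ⌊1+kφ²⌋≡ (upper k)

-- The test holds exactly when m = ⌊kφ⌋ for some k ≥ 1 (jump₂⇒lower), so σ is the formula of
-- the theorem; for m = 0 both branches give 1.
σ : ℕ → ℕ
σ zero = 0
σ (suc m) = if does (2 + ⌊ m φ⌋ ≤φ·? suc m) then ⌊ suc m φ⌋ else suc ⌊ suc m /φ⌋

σ-jump₂ : ∀ {m} → ⌊ suc m φ⌋ ≡ 2 + ⌊ m φ⌋ → σ (suc m) ≡ ⌊ suc m φ⌋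
σ-jump₂ {m} jump with 2 + ⌊ m φ⌋ ≤φ·? suc m
... | yes _ = refl
... | no _ = ⊥-elim (1+n≢n (sym (suc-injective jump)))

σ-jump₁ : ∀ {m} → ⌊ suc m φ⌋ ≡ suc ⌊ m φ⌋ → σ (suc m) ≡ suc ⌊ suc m /φ⌋
σ-jump₁ {m} jump with 2 + ⌊ m φ⌋ ≤φ·? suc m
... | yes _ = ⊥-elim (1+n≢n (suc-injective jump))
... | no _ = refl

σ-one : σ 1 ≡ 1
σ-one = trans (σ-jump₁ ⌊1φ⌋) (cong (λ y → suc (y ∸ 1)) ⌊1φ⌋)

σ-on-lower : ∀ k {m} → ⌊ k φ⌋ ≡ m → σ (suc m) ≡ ⌊ suc m φ⌋
σ-on-lower zero refl = trans σ-one (sym ⌊1φ⌋)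
σ-on-lower (suc k) refl = σ-jump₂ (⌊φ⌋-jump-at-lower k)

σ-off-lower : ∀ {m} → (∀ k → ⌊ k φ⌋ ≢ m) → σ (suc m) ≡ suc ⌊ suc m /φ⌋
σ-off-lower {m} not-lower with ⌊φ⌋-step m
... | inj₁ jump = ⊥-elim (not-lower (suc ⌊ m /φ⌋) (jump₂⇒lower m jump))
... | inj₂ jump = σ-jump₁ jump

σ-after-lower : ∀ k → σ (suc ⌊ suc k φ⌋) ≡ suc ⌊ suc k φ²⌋
σ-after-lower k = trans (σ-jump₂ (⌊φ⌋-jump-at-lower k)) (⌊φ⌋-after-lower k)

σ-after-upper : ∀ k → σ (suc ⌊ suc k φ²⌋) ≡ suc ⌊ suc k φ⌋
σ-after-upper k = trans (σ-jump₁ (⌊φ⌋-jump-at-upper k))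
  (cong suc (trans (cong (_∸ suc ⌊ suc k φ²⌋) (⌊φ⌋-after-upper k)) (m+n∸m≡n (suc ⌊ suc k φ²⌋) ⌊ suc k φ⌋)))

σ-involutive : ∀ n → σ (σ n) ≡ n
σ-involutive zero = refl
σ-involutive (suc m) with beattyView m
... | origin = trans (cong σ σ-one) σ-one
... | lower k = trans (cong σ (σ-after-lower k)) (σ-after-upper k)
... | upper k = trans (cong σ (σ-after-upper k)) (σ-after-lower k)

σ-injective : ∀ {i j} → σ i ≡ σ j → i ≡ j
σ-injective {i} {j} σi≡σj = trans (sym (σ-involutive i)) (trans (cong σ σi≡σj) (σ-involutive j))

σ≤⌊φ⌋ : ∀ n → σ n ≤ ⌊ n φ⌋
σ≤⌊φ⌋ zero = z≤n
σ≤⌊φ⌋ (suc m) with ⌊φ⌋-step m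
... | inj₁ jump = ≤-reflexive (σ-jump₂ jump)
... | inj₂ jump = subst₂ _≤_ (sym (trans (σ-jump₁ jump) (cong suc (⌊/φ⌋-jump₁ jump)))) (sym jump)
                         (s≤s (m∸n≤m ⌊ m φ⌋ m))

σ-sum : ∀ m → Σ1 σ m ≡ m * suc ⌊ m /φ⌋
σ-sum zero = refl
σ-sum (suc m) with ⌊φ⌋-step m
... | inj₁ jump = begin
  Σ1 σ m + σ (suc m)                  ≡⟨ cong₂ _+_ (σ-sum m) (trans (σ-jump₂ jump) (⌊φ⌋≡+⌊/φ⌋ (suc m))) ⟩
  m * suc z + (suc m + ⌊ suc m /φ⌋)   ≡⟨ cong (λ w → m * suc z + (suc m + w)) (⌊/φ⌋-jump₂ jump) ⟩
  m * suc z + (suc m + suc z)         ≡⟨ expand m z ⟩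
  suc m * suc (suc z)                 ≡⟨ cong (λ w → suc m * suc w) (sym (⌊/φ⌋-jump₂ jump)) ⟩
  suc m * suc ⌊ suc m /φ⌋             ∎
  where
    open ≡-Reasoning
    z = ⌊ m /φ⌋
    expand : ∀ m z → m * suc z + (suc m + suc z) ≡ suc m * suc (suc z)
    expand = solve-∀
... | inj₂ jump = begin
  Σ1 σ m + σ (suc m)          ≡⟨ cong₂ _+_ (σ-sum m) (σ-jump₁ jump) ⟩
  m * suc z + suc ⌊ suc m /φ⌋ ≡⟨ cong (λ w → m * suc z + suc w) (⌊/φ⌋-jump₁ jump) ⟩
  m * suc z + suc z           ≡⟨ +-comm (m * suc z) (suc z) ⟩
  suc m * suc z               ≡⟨ cong (λ w → suc m * suc w) (sym (⌊/φ⌋-jump₁ jump)) ⟩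
  suc m * suc ⌊ suc m /φ⌋     ∎
  where
    open ≡-Reasoning
    z = ⌊ m /φ⌋

σ-prefix-divisible : ∀ m → suc m ∣ Σ1 σ m + σ (suc m)
σ-prefix-divisible m = subst (suc m ∣_) (sym (σ-sum (suc m))) (m∣m*n _)

σ-admissible : ∀ m → Admissible σ m (σ (suc m))
σ-admissible m = (λ i i<1+m σi≡σ1+m → <-irrefl (σ-injective σi≡σ1+m) i<1+m) , σ-prefix-divisible m

σ-gap : ∀ m {y} → y < σ (suc m) → suc m ∣ Σ1 σ m + y → suc m ∣ σ (suc m) ∸ y
σ-gap m {y} y<σ ∣S+y = ∣m+n∣m⇒∣n (subst (suc m ∣_) split (σ-prefix-divisible m)) ∣S+y
  where
    split : Σ1 σ m + σ (suc m) ≡ (Σ1 σ m + y) + (σ (suc m) ∸ y)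
    split = trans (cong (Σ1 σ m +_) (sym (m+[n∸m]≡n (<⇒≤ y<σ)))) (sym (+-assoc (Σ1 σ m) y _))

∣n+r∸y⇒y≡r : ∀ {n r y} → r < n → y < n + r → n ∣ (n + r) ∸ y → y ≡ r
∣n+r∸y⇒y≡r {n} {r} {y} r<n y<n+r n∣ with <-cmp y r
... | tri≈ _ y≡r _ = y≡r
... | tri< y<r _ _ = ⊥-elim (<⇒≱ (≤-<-trans (m∸n≤m r y) r<n) (∣⇒≤ ⦃ >-nonZero (m<n⇒0<n∸m y<r) ⦄ n∣r∸y))
  where
    n∣r∸y : n ∣ r ∸ y
    n∣r∸y = ∣m+n∣m⇒∣n (subst (n ∣_) (+-∸-assoc n (<⇒≤ y<r)) n∣) (n∣n)
... | tri> _ _ r<y = ⊥-elim (<⇒≱ below (∣⇒≤ ⦃ >-nonZero (m<n⇒0<n∸m y<n+r) ⦄ n∣))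
  where
    below : (n + r) ∸ y < n
    below = subst ((n + r) ∸ y <_) (m+n∸n≡m n r) (∸-monoʳ-< r<y (<⇒≤ y<n+r))

σ-least : ∀ m y → y < σ (suc m) → ¬ Admissible σ m y
σ-least m zero _ (fresh , _) = fresh 0 (s≤s z≤n) refl
σ-least m y@(suc y′) y<σ (fresh , ∣S+y) with ⌊φ⌋-step m
... | inj₁ jump = fresh (σ r) (s≤s (subst (σ r ≤_) m≡ (σ≤⌊φ⌋ r))) (trans (σ-involutive r) (sym y≡r))
  where
    r = suc ⌊ m /φ⌋
    m≡ : ⌊ r φ⌋ ≡ m
    m≡ = jump₂⇒lower m jump
    σ≡ : σ (suc m) ≡ suc m + r
    σ≡ = trans (σ-jump₂ jump) (trans (⌊φ⌋≡+⌊/φ⌋ (suc m)) (cong (suc m +_) (⌊/φ⌋-jump₂ jump)))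
    y≡r : y ≡ r
    y≡r = ∣n+r∸y⇒y≡r (s≤s (subst (r ≤_) m≡ (n≤⌊nφ⌋ r))) (subst (y <_) σ≡ y<σ)
                      (subst (λ s → suc m ∣ s ∸ y) σ≡ (σ-gap m y<σ ∣S+y))
... | inj₂ jump = 1+n≰n (≤-trans (∣⇒≤ ⦃ >-nonZero (m<n⇒0<n∸m y<σ) ⦄ (σ-gap m y<σ ∣S+y)) gap≤m)
  where
    gap≤m : σ (suc m) ∸ y ≤ m
    gap≤m = subst (λ s → s ∸ y ≤ m) (sym (trans (σ-jump₁ jump) (cong suc (⌊/φ⌋-jump₁ jump))))
                  (≤-trans (m∸n≤m ⌊ m /φ⌋ y′) (⌊/φ⌋≤ m))

σ-isA019444 : IsA019444 σ
σ-isA019444 = refl , λ m → σ-admissible m , σ-least m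

Σ1-cong : ∀ {f g} m → (∀ {i} → i ≤ m → f i ≡ g i) → Σ1 f m ≡ Σ1 g m
Σ1-cong zero _ = refl
Σ1-cong (suc m) f≗g = cong₂ _+_ (Σ1-cong m (λ i≤m → f≗g (m≤n⇒m≤1+n i≤m))) (f≗g ≤-refl)

Admissible-cong : ∀ {f g} m {y} → (∀ {i} → i ≤ m → f i ≡ g i) → Admissible f m y → Admissible g m y
Admissible-cong {f} {g} m {y} f≗g (fresh , ∣S+y) =
  (λ i i<1+m gi≡y → fresh i i<1+m (trans (f≗g (≤-pred i<1+m)) gi≡y)) ,
  subst (λ s → suc m ∣ s + y) (Σ1-cong m f≗g) ∣S+y

IsA019444-unique : ∀ {f g} → IsA019444 f → IsA019444 g → ∀ n → f n ≡ g n
IsA019444-unique {f} {g} (f0 , f-least) (g0 , g-least) n = agree n ≤-refl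
  where
    agree : ∀ m {i} → i ≤ m → f i ≡ g i
    agree zero z≤n = trans f0 (sym g0)
    agree (suc m) i≤1+m with m≤n⇒m<n∨m≡n i≤1+m
    ... | inj₁ i<1+m = agree m (≤-pred i<1+m)
    ... | inj₂ refl = ≤-antisym
      (≮⇒≥ λ g<f → proj₂ (f-least m) _ g<f
        (Admissible-cong m (λ i≤m → sym (agree m i≤m)) (proj₁ (g-least m))))
      (≮⇒≥ λ f<g → proj₂ (g-least m) _ f<g
        (Admissible-cong m (agree m) (proj₁ (f-least m))))

theorem4 : (f : ℕ → ℕ) → IsA019444 f → (n : ℕ) → 1 ≤ n →
    ((∃ λ m → IsFloorMulPhi m (n ∸ 1)) → IsFloorMulPhi n (f n))
    × ((¬ (∃ λ m → IsFloorMulPhi m (n ∸ 1))) → ∃ λ k → IsFloorDivPhi n k × f n ≡ suc k)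
theorem4 f hf zero ()
theorem4 f hf (suc m) _ = on-lower , off-lower
  where
    f≡σ : f (suc m) ≡ σ (suc m)
    f≡σ = IsA019444-unique hf σ-isA019444 (suc m)
    on-lower : (∃ λ k → IsFloorMulPhi k m) → IsFloorMulPhi (suc m) (f (suc m))
    on-lower (k , m-floor) = subst (IsFloorMulPhi (suc m))
      (sym (trans f≡σ (σ-on-lower k (isFloorMulPhi⇒⌊φ⌋≡ k m-floor)))) (⌊φ⌋-isFloorMulPhi (suc m))
    off-lower : ¬ (∃ λ k → IsFloorMulPhi k m) → ∃ λ k → IsFloorDivPhi (suc m) k × f (suc m) ≡ suc k
    off-lower not-lower = ⌊ suc m /φ⌋ , ⌊/φ⌋-isFloorDivPhi (suc m) ,
      trans f≡σ (σ-off-lower λ k ⌊kφ⌋≡m →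
        not-lower (k , subst (IsFloorMulPhi k) ⌊kφ⌋≡m (⌊φ⌋-isFloorMulPhi k)))
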